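{- Let $\sigma$ be a maximal repeat in a word $w$. Then $\sigma$ is the principal repeat of some maximal repetition or maximal subrepetition of $w$ if and only if $\sigma$ is not covered by any other maximal repeat of $w$.
   Context: $w$ has length $n$. For a factor $w[i..j]$ we write $\mathrm{beg}=i$ and $\mathrm{end}=j$; $u$ is contained in $v$ if $\mathrm{beg}(v)\le\mathrm{beg}(u)$ and $\mathrm{end}(u)\le\mathrm{end}(v)$. A period of a word $x$ is any $p$ with $x[i]=x[i+p]$ for all valid $i$; $p(x)$ is the minimal period and $e(x)=|x|/p(x)$. A factor $r$ is maximal if two conditions hold: if $\mathrm{beg}(r)>1$ then $w[\mathrm{beg}(r)-1]\ne w[\mathrm{beg}(r)+p(r)-1]$, and if $\mathrm{end}(r)<n$ then $w[\mathrm{end}(r)-p(r)+1]\ne w[\mathrm{end}(r)+1]$. Repetitions have $e\ge2$; subrepetitions have $1<e<2$. A repeat $\sigma$ is a pair $(u',u'')$ of nonempty factors equal as words, with $\mathrm{beg}(u')<\mathrm{beg}(u'')$. Its period is $p(\sigma)=\mathrm{beg}(u'')-\mathrm{beg}(u')$, and $\mathrm{fact}(\sigma)=w[\mathrm{beg}(u')..\mathrm{end}(u'')]$. It is maximal if two conditions hold: if $\mathrm{beg}(u')>1$ then $w[\mathrm{beg}(u')-1]\ne w[\mathrm{beg}(u'')-1]$, and if $\mathrm{end}(u'')<n$ then $w[\mathrm{end}(u')+1]\ne w[\mathrm{end}(u'')+1]$. A maximal repeat $\sigma$ is covered by a maximal repeat $\sigma'$ if $\mathrm{fact}(\sigma)$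 is contained in $\mathrm{fact}(\sigma')$ and $p(\sigma')<p(\sigma)$. The principal repeat of a maximal repetition or maximal subrepetition $r$ has copies $w[\mathrm{beg}(r)..\mathrm{end}(r)-p(r)]$ and $w[\mathrm{beg}(r)+p(r)..\mathrm{end}(r)]$. -}

module Defs where

open import Data.Nat using (ℕ; zero; suc; _+_; _*_; _∸_; _≤_; _<_)
open import Data.List using (List; []; _∷_; length)
open import Data.Maybe using (Maybe; just; nothing)
open import Data.Product using (Σ; _×_)
open import Data.Sum using (_⊎_)
open import Relation.Binary.PropositionalEquality using (_≡_; _≢_)

-- Words are lists over an arbitrary alphabet A.
-- POSITIONS ARE 0-INDEXED: position k of w (0 ≤ k < length w) corresponds
-- to the paper's position k+1.  All accesses below are in range.
at : {A : Set} → List A → ℕ → Maybe A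
at []       _       = nothing
at (x ∷ xs) zero    = just x
at (x ∷ xs) (suc k) = at xs k

-- Factors: a factor is given by its start position i and length L,
-- i.e. it is w[i .. i+L-1] (0-indexed), with L ≥ 1 and i + L ≤ |w|.

IsFactor : {A : Set} → List A → ℕ → ℕ → Set
IsFactor w i L = (1 ≤ L) × (i + L ≤ length w)

IsPeriod : {A : Set} → List A → ℕ → ℕ → ℕ → Set
IsPeriod w i L p =
  (1 ≤ p) × (∀ k → i ≤ k → k + p < i + L → at w k ≡ at w (k + p))

IsMinPeriod : {A : Set} → List A → ℕ → ℕ → ℕ → Set
IsMinPeriod w i L p = IsPeriod w i L p × (∀ q → IsPeriod w i L q → p ≤ q)

-- The factor (i, L) is maximal, where p = p(r):
--  if beg(r) > 1 then w[beg(r)-1] ≠ w[beg(r)+p(r)-1], and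
--  if end(r) < n then w[end(r)-p(r)+1] ≠ w[end(r)+1].
-- (translated to 0-indexing: beg = i, end = i + L - 1)
IsMaximalFactor : {A : Set} → List A → ℕ → ℕ → ℕ → Set
IsMaximalFactor w i L p =
  (∀ i′ → i ≡ suc i′ → at w i′ ≢ at w (i′ + p)) ×
  (i + L < length w → at w (i + L ∸ p) ≢ at w (i + L))

-- r = (i, L) is a maximal repetition of w with minimal period p = p(r):
-- e(r) = L / p ≥ 2, i.e. 2p ≤ L.
IsMaxRepetition : {A : Set} → List A → ℕ → ℕ → ℕ → Set
IsMaxRepetition w i L p =
  IsFactor w i L × IsMinPeriod w i L p × (2 * p ≤ L) × IsMaximalFactor w i L p

-- r = (i, L) is a maximal subrepetition of w with minimal period p = p(r):
-- 1 < e(r) = L / p < 2, i.e. p < L < 2p.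
IsMaxSubrepetition : {A : Set} → List A → ℕ → ℕ → ℕ → Set
IsMaxSubrepetition w i L p =
  IsFactor w i L × IsMinPeriod w i L p × (p < L) × (L < 2 * p) ×
  IsMaximalFactor w i L p

-- Repeats: a repeat σ = (u′, u″) is given by b₁ = beg(u′), b₂ = beg(u″)
-- and the common length len = |u′| = |u″|.

record Repeat : Set where
  constructor rep
  field
    b₁ b₂ len : ℕ

open Repeat public

IsRepeat : {A : Set} → List A → Repeat → Set
IsRepeat w (rep b₁ b₂ m) =
  (1 ≤ m) × (b₁ < b₂) × (b₂ + m ≤ length w) ×
  (∀ k → k < m → at w (b₁ + k) ≡ at w (b₂ + k))

period : Repeat → ℕ
period σ = b₂ σ ∸ b₁ σ

-- fact(σ) = w[beg(u′) .. end(u″)]: starts at b₁, ends (exclusive) at b₂ + len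
factBeg factEnd : Repeat → ℕ
factBeg σ = b₁ σ
factEnd σ = b₂ σ + len σ

-- maximal repeat:
--  if beg(u′) > 1 then w[beg(u′)-1] ≠ w[beg(u″)-1], and
--  if end(u″) < n then w[end(u′)+1] ≠ w[end(u″)+1].
IsMaximalRepeat : {A : Set} → List A → Repeat → Set
IsMaximalRepeat w σ@(rep b₁ b₂ m) =
  IsRepeat w σ ×
  (∀ c₁ c₂ → b₁ ≡ suc c₁ → b₂ ≡ suc c₂ → at w c₁ ≢ at w c₂) ×
  (b₂ + m < length w → at w (b₁ + m) ≢ at w (b₂ + m))

CoveredBy : {A : Set} → List A → Repeat → Repeat → Set
CoveredBy w σ σ′ =
  IsMaximalRepeat w σ × IsMaximalRepeat w σ′ ×
  (factBeg σ′ ≤ factBeg σ) × (factEnd σ ≤ factEnd σ′) ×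
  (period σ′ < period σ)

-- principal repeat of r = (i, L) with p = p(r): copies
-- w[beg(r) .. end(r)-p(r)] and w[beg(r)+p(r) .. end(r)]
principal : ℕ → ℕ → ℕ → Repeat
principal i L p = rep i (i + p) (L ∸ p)

IsPrincipal : {A : Set} → List A → Repeat → Set
IsPrincipal w σ =
  Σ ℕ λ i → Σ ℕ λ L → Σ ℕ λ p →
    (IsMaxRepetition w i L p ⊎ IsMaxSubrepetition w i L p) ×
    (principal i L p ≡ σ)

module Submission where

-- A maximal repeat σ of period p is the same thing as a stretch fact(σ) of
-- period p that extends neither to the left nor to the right, and σ is
-- principal exactly when p is the minimal period of fact(σ).  A covering
-- repeat of period q < p makes q a period of fact(σ).  Conversely, if some
-- q < p is a period of fact(σ), extending the q-periodic stretch letter by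
-- letter as far as it goes yields a maximal repeat of period q covering σ.

open import Defs
open import Data.List using (List; length)
open import Data.Nat using (ℕ; zero; suc; _+_; _*_; _∸_; _≤_; _<_; _≤?_)
open import Data.Nat.Properties
open import Algebra.Properties.CommutativeSemigroup +-commutativeSemigroup
  using (xy∙z≈xz∙y)
open import Data.Product using (Σ; _×_; _,_)
open import Data.Sum using (_⊎_; inj₁; inj₂)
open import Data.Empty using (⊥-elim)
open import Effect.Monad using (RawMonad)
open import Function.Bundles using (_⇔_; mk⇔; Equivalence)
import Function.Properties.Equivalence as ⇔
open import Level using (0ℓ)
open import Relation.Nullary using (¬_; yes; no; contradiction)
open import Relation.Nullary.Decidable using (¬¬-excluded-middle)
open import Relation.Nullary.Negation using (¬¬-Monad; ¬¬-map)
open import Relation.Binary.PropositionalEquality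

open RawMonad (¬¬-Monad {a = 0ℓ})

m<n⇒∃[o>0]m+o≡n : ∀ {m n} → m < n → Σ ℕ λ o → 1 ≤ o × m + o ≡ n
m<n⇒∃[o>0]m+o≡n {m} {n} m<n = n ∸ m , m<n⇒0<n∸m m<n , m+[n∸m]≡n (<⇒≤ m<n)

m<m+n⇒0<n : ∀ m {n} → m < m + n → 0 < n
m<m+n⇒0<n m {n} m<m+n = +-cancelˡ-≤ m 1 n (subst (_≤ m + n) (sym (+-comm m 1)) m<m+n)

module _ {A : Set} (w : List A) where

  Periodic : ℕ → ℕ → ℕ → Set
  Periodic q a e = ∀ k → a ≤ k → k + q < e → at w k ≡ at w (k + q)

  LeftMaximal : ℕ → ℕ → Set
  LeftMaximal q a = ∀ c → a ≡ suc c → at w c ≢ at w (c + q)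

  RightMaximal : ℕ → ℕ → Set
  RightMaximal q e = e < length w → at w (e ∸ q) ≢ at w e

  IsMaximalRun : ℕ → ℕ → ℕ → Set
  IsMaximalRun q a e = Periodic q a e × LeftMaximal q a × RightMaximal q e

  MaximalRunAround : ℕ → ℕ → ℕ → Set
  MaximalRunAround q a e =
    Σ ℕ λ s → Σ ℕ λ t → s ≤ a × e ≤ t × t ≤ length w × IsMaximalRun q s t

  periodic-restrict : ∀ {q a a′ e e′} → a ≤ a′ → e′ ≤ e →
                      Periodic q a e → Periodic q a′ e′
  periodic-restrict a≤a′ e′≤e per k a′≤k k+q<e′ =
    per k (≤-trans a≤a′ a′≤k) (<-≤-trans k+q<e′ e′≤e)

  periodic-extendˡ : ∀ {q c e} → at w c ≡ at w (c + q) →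
                     Periodic q (suc c) e → Periodic q c e
  periodic-extendˡ eq per k c≤k k+q<e with m≤n⇒m<n∨m≡n c≤k
  ... | inj₁ c<k  = per k c<k k+q<e
  ... | inj₂ refl = eq

  periodic-extendʳ : ∀ {q a e} → at w (e ∸ q) ≡ at w e →
                     Periodic q a e → Periodic q a (suc e)
  periodic-extendʳ {q} eq per k a≤k k+q<1+e
    with m≤n⇒m<n∨m≡n (≤-pred k+q<1+e)
  ... | inj₁ k+q<e = per k a≤k k+q<e
  ... | inj₂ refl  = subst (λ j → at w j ≡ at w (k + q)) (m+n∸n≡m k q) eq

  -- Equality of letters is not decidable over an arbitrary alphabet, so the
  -- extensions are only established under double negation.
  periodic⇒¬¬leftMaximal : ∀ {q e} a → Periodic q a e →
    ¬ ¬ (Σ ℕ λ s → s ≤ a × Periodic q s e × LeftMaximal q s)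
  periodic⇒¬¬leftMaximal zero per = pure (0 , ≤-refl , per , λ _ ())
  periodic⇒¬¬leftMaximal (suc c) per = ¬¬-excluded-middle >>= λ where
    (yes eq) → (λ (s , s≤c , per′ , lm) → s , m≤n⇒m≤1+n s≤c , per′ , lm)
               <$> periodic⇒¬¬leftMaximal c (periodic-extendˡ eq per)
    (no neq) → pure (suc c , ≤-refl , per , λ { _ refl → neq })

  periodic⇒¬¬rightMaximal : ∀ {q a e} d → d + e ≡ length w → Periodic q a e →
    ¬ ¬ (Σ ℕ λ t → e ≤ t × t ≤ length w × Periodic q a t × RightMaximal q t)
  periodic⇒¬¬rightMaximal zero refl per =
    pure (length w , ≤-refl , ≤-refl , per , λ n<n → contradiction n<n (<-irrefl refl))
  periodic⇒¬¬rightMaximal {e = e} (suc d) d+e≡n per = ¬¬-excluded-middle >>= λ where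
    (yes eq) → (λ (t , e<t , t≤n , per′ , rm) → t , <⇒≤ e<t , t≤n , per′ , rm)
               <$> periodic⇒¬¬rightMaximal d (trans (+-suc d e) d+e≡n)
                                                (periodic-extendʳ eq per)
    (no neq) → pure (e , ≤-refl , ≤-trans (m≤n+m e (suc d)) (≤-reflexive d+e≡n) ,
                     per , λ _ → neq)

  periodic⇒¬¬maximalRun : ∀ {q a e} → e ≤ length w → Periodic q a e →
    ¬ ¬ MaximalRunAround q a e
  periodic⇒¬¬maximalRun {a = a} {e} e≤n per = do
    s , s≤a , per₁ , lm ← periodic⇒¬¬leftMaximal a per
    t , e≤t , t≤n , per₂ , rm ←
      periodic⇒¬¬rightMaximal (length w ∸ e) (m∸n+n≡m e≤n) per₁
    pure (s , t , s≤a , e≤t , t≤n , per₂ , lm , rm)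

  copies⇔periodic : ∀ {s q m} →
    (∀ k → k < m → at w (s + k) ≡ at w (s + q + k)) ⇔ Periodic q s (s + q + m)
  copies⇔periodic {s} {q} {m} = mk⇔ copies⇒periodic periodic⇒copies
    where
    copies⇒periodic : (∀ k → k < m → at w (s + k) ≡ at w (s + q + k)) →
                      Periodic q s (s + q + m)
    copies⇒periodic copies k s≤k k+q<e with m≤n⇒∃[o]m+o≡n s≤k
    ... | j , refl = subst (λ x → at w (s + j) ≡ at w x) (xy∙z≈xz∙y s q j) (copies j j<m)
      where
      j<m : j < m
      j<m = +-cancelˡ-< (s + q) j m (subst (_< s + q + m) (xy∙z≈xz∙y s j q) k+q<e)
    periodic⇒copies : Periodic q s (s + q + m) →
                      ∀ k → k < m → at w (s + k) ≡ at w (s + q + k)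
    periodic⇒copies per k k<m =
      subst (λ x → at w (s + k) ≡ at w x) (xy∙z≈xz∙y s k q)
        (per (s + k) (m≤m+n s k)
          (subst (_< s + q + m) (xy∙z≈xz∙y s q k) (+-monoʳ-< (s + q) k<m)))

  maximalRepeat⇔maximalRun : ∀ {s q m} → 1 ≤ q → 1 ≤ m → s + q + m ≤ length w →
    IsMaximalRepeat w (rep s (s + q) m) ⇔ IsMaximalRun q s (s + q + m)
  maximalRepeat⇔maximalRun {s} {q} {m} 1≤q 1≤m e≤n = mk⇔
    (λ ((_ , _ , _ , copies) , lm , rm) →
       Equivalence.to copies⇔periodic copies ,
       (λ { c refl → lm c (c + q) refl refl }) ,
       λ e<n → subst (λ x → at w x ≢ at w (s + q + m)) (sym e∸q≡s+m) (rm e<n))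
    (λ (per , lm , rm) →
       (1≤m , m<m+n s 1≤q , e≤n , Equivalence.from copies⇔periodic per) ,
       (λ { c₁ c₂ refl refl → lm c₁ refl }) ,
       λ e<n → subst (λ x → at w x ≢ at w (s + q + m)) e∸q≡s+m (rm e<n))
    where
    e∸q≡s+m : s + q + m ∸ q ≡ s + m
    e∸q≡s+m = trans (cong (_∸ q) (xy∙z≈xz∙y s q m)) (m+n∸n≡m (s + m) q)

  covered⇒shorterPeriod : ∀ {b p m σ′} → CoveredBy w (rep b (b + p) m) σ′ →
                          Σ ℕ λ q → q < p × IsPeriod w b (p + m) q
  covered⇒shorterPeriod {b} {p} {m} {rep b′ b₂′ m′}
    (_ , ((_ , b′<b₂′ , _ , copies) , _) , b′≤b , e≤e′ , period<period)
    with m<n⇒∃[o>0]m+o≡n b′<b₂′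
  ... | q , 1≤q , refl =
    q , subst₂ _<_ (m+n∸m≡n b′ q) (m+n∸m≡n b p) period<period ,
    1≤q , periodic-restrict b′≤b (≤-trans (≤-reflexive (sym (+-assoc b p m))) e≤e′)
            (Equivalence.to copies⇔periodic copies)

  shorterPeriod⇒¬¬covered : ∀ {b p m q} → IsMaximalRepeat w (rep b (b + p) m) →
    q < p → IsPeriod w b (p + m) q → ¬ ¬ Σ Repeat (CoveredBy w (rep b (b + p) m))
  shorterPeriod⇒¬¬covered {b} {p} {m} {q} σ-max@((_ , _ , e≤n , _) , _) q<p (1≤q , per) =
    ¬¬-map covering (periodic⇒¬¬maximalRun (subst (_≤ length w) (+-assoc b p m) e≤n) per)
    where
    covering : MaximalRunAround q b (b + (p + m)) → Σ Repeat (CoveredBy w (rep b (b + p) m))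
    covering (s , t , s≤b , e≤t , t≤n , run)
      with m<n⇒∃[o>0]m+o≡n
             (<-≤-trans (+-mono-≤-< s≤b (<-≤-trans q<p (m≤m+n p m))) e≤t)
    ... | m′ , 1≤m′ , refl =
      rep s (s + q) m′ , σ-max ,
      Equivalence.from (maximalRepeat⇔maximalRun 1≤q 1≤m′ t≤n) run , s≤b ,
      subst (_≤ s + q + m′) (sym (+-assoc b p m)) e≤t ,
      subst₂ _<_ (sym (m+n∸m≡n s q)) (sym (m+n∸m≡n b p)) q<p

  repeat⇒period : ∀ {b p m} → IsRepeat w (rep b (b + p) m) → IsPeriod w b (p + m) p
  repeat⇒period {b} {p} {m} (_ , b<b+p , _ , copies) =
    m<m+n⇒0<n b b<b+p ,
    subst (λ e → Periodic p b e) (+-assoc b p m) (Equivalence.to copies⇔periodic copies)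

  uncovered⇔minimalPeriod : ∀ {b p m} → IsMaximalRepeat w (rep b (b + p) m) →
    (¬ Σ Repeat (CoveredBy w (rep b (b + p) m))) ⇔ IsMinPeriod w b (p + m) p
  uncovered⇔minimalPeriod {b} {p} {m} σ-max@(σ-rep , _) = mk⇔
    (λ uncovered → repeat⇒period σ-rep , minimal uncovered)
    (λ (_ , minimal) (_ , covered) →
       let q , q<p , per = covered⇒shorterPeriod covered in <⇒≱ q<p (minimal q per))
    where
    minimal : ¬ Σ Repeat (CoveredBy w (rep b (b + p) m)) →
              ∀ q → IsPeriod w b (p + m) q → p ≤ q
    minimal uncovered q per with p ≤? q
    ... | yes p≤q = p≤q
    ... | no  p≰q = ⊥-elim (shorterPeriod⇒¬¬covered σ-max (≰⇒> p≰q) per uncovered)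

  maxRepetition⊎maxSubrepetition : ∀ {i L p} → IsFactor w i L → IsMinPeriod w i L p →
    p < L → IsMaximalFactor w i L p → IsMaxRepetition w i L p ⊎ IsMaxSubrepetition w i L p
  maxRepetition⊎maxSubrepetition {L = L} {p} fac min p<L maxf with 2 * p ≤? L
  ... | yes 2p≤L = inj₁ (fac , min , 2p≤L , maxf)
  ... | no  2p≰L = inj₂ (fac , min , p<L , ≰⇒> 2p≰L , maxf)

  maxRepetition⊎maxSubrepetition⇒minimalPeriod : ∀ {i L p} →
    IsMaxRepetition w i L p ⊎ IsMaxSubrepetition w i L p → IsMinPeriod w i L p × p ≤ L
  maxRepetition⊎maxSubrepetition⇒minimalPeriod {p = p} (inj₁ (_ , min , 2p≤L , _)) =
    min , ≤-trans (m≤m+n p (p + 0)) 2p≤L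
  maxRepetition⊎maxSubrepetition⇒minimalPeriod (inj₂ (_ , min , p<L , _)) = min , <⇒≤ p<L

  principal-injective : ∀ {i L p b q m} → p ≤ L → principal i L p ≡ rep b (b + q) m →
                        i ≡ b × p ≡ q × L ≡ q + m
  principal-injective {i} {L} {p} {b} {q} {m} p≤L eq = i≡b , p≡q , L≡q+m
    where
    i≡b : i ≡ b
    i≡b = cong b₁ eq
    p≡q : p ≡ q
    p≡q = +-cancelˡ-≡ b p q (subst (λ x → x + p ≡ b + q) i≡b (cong b₂ eq))
    L≡q+m : L ≡ q + m
    L≡q+m = trans (sym (m+[n∸m]≡n p≤L)) (cong₂ _+_ p≡q (cong len eq))

  principal⇒minimalPeriod : ∀ {b p m} → IsPrincipal w (rep b (b + p) m) →
                            IsMinPeriod w b (p + m) p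
  principal⇒minimalPeriod (i , L , p , r , eq)
    with maxRepetition⊎maxSubrepetition⇒minimalPeriod r
  ... | min , p≤L with principal-injective p≤L eq
  ... | refl , refl , refl = min

  minimalPeriod⇒principal : ∀ {b p m} → IsMaximalRepeat w (rep b (b + p) m) →
    IsMinPeriod w b (p + m) p → IsPrincipal w (rep b (b + p) m)
  minimalPeriod⇒principal {b} {p} {m} σ-max@((1≤m , _ , e≤n , _) , _)
                                      min@((1≤p , _) , _) =
    b , p + m , p , maxRepetition⊎maxSubrepetition factor min (m<m+n p 1≤m) maximal ,
    cong (rep b (b + p)) (m+n∸m≡n p m)
    where
    factor : IsFactor w b (p + m)
    factor = ≤-trans 1≤m (m≤n+m m p) , subst (_≤ length w) (+-assoc b p m) e≤n
    maximal : IsMaximalFactor w b (p + m) p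
    maximal with Equivalence.to (maximalRepeat⇔maximalRun 1≤p 1≤m e≤n) σ-max
    ... | _ , lm , rm = lm , subst (RightMaximal p) (+-assoc b p m) rm

  principal⇔minimalPeriod : ∀ {b p m} → IsMaximalRepeat w (rep b (b + p) m) →
    IsPrincipal w (rep b (b + p) m) ⇔ IsMinPeriod w b (p + m) p
  principal⇔minimalPeriod σ-max =
    mk⇔ principal⇒minimalPeriod (minimalPeriod⇒principal σ-max)

proposition13 : {A : Set} (w : List A) (σ : Repeat) →
    IsMaximalRepeat w σ →
    IsPrincipal w σ ⇔ (¬ Σ Repeat (λ σ′ → CoveredBy w σ σ′))
proposition13 w (rep b b₂ m) σ-max@((_ , b<b₂ , _) , _) with m≤n⇒∃[o]m+o≡n (<⇒≤ b<b₂)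
... | p , refl =
  ⇔.trans (principal⇔minimalPeriod w σ-max) (⇔.sym (uncovered⇔minimalPeriod w σ-max))
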